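{- For every nonzero integer $r$ and every positive integer $n$, $$a(n,r)=\sum_{k=0}^n\binom nk k!\,r^k.$$
   Context: For a positive integer $r$, $C_r$ is the cyclic group of order $r$ and $C_r\wr S_n=\mathrm{Fun}([n],C_r)\rtimes S_n$, where $S_n$ acts on functions by precomposition; it acts on $C_r\times[n]$ by $(f,\sigma)(s,m)=(s+f(\sigma(m)),\sigma(m))$. An $r$-cyclic derangement of degree $n$ is an element of $C_r\wr S_n$ whose action on $C_r\times[n]$ has no fixed point. An $r$-cyclic arrangement of degree $n$ is a pair consisting of a subset $A\subset[n]$ and an element of $C_r\wr S_{|A|}$. For a nonzero integer $r$, $a(n,r)$ is the number of $r$-cyclic arrangements of degree $n$ if $r>0$, and $(-1)^n$ times the number of $|r|$-cyclic derangements of degree $n$ if $r<0$. -}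

module Defs where

open import Data.Nat using (ℕ; zero; suc; NonZero)
open import Data.Nat.DivMod using (_mod_)
open import Data.Bool using (Bool; true; false)
open import Data.Fin using (Fin; toℕ; _≟_)
open import Data.Fin.Properties using (all?; any?)
open import Data.List using (List; []; _∷_; map; concatMap; filter; length; cartesianProduct; allFin; foldr; upTo)
open import Data.Product using (Σ; ∃; _×_; _,_)
open import Data.Product.Properties using (≡-dec)
open import Data.Integer as ℤ using (ℤ; +_; -[1+_])
open import Data.Nat.Combinatorics using (_C_)
open import Data.Nat using (_!)
open import Relation.Nullary using (Dec; yes; no; ¬_; _×-dec_; ¬?)
open import Relation.Binary.PropositionalEquality using (_≡_)
open import Relation.Nullary.Decidable using (_→-dec_)

allFuns : ∀ {A : Set} (n : ℕ) → List A → List (Fin n → A)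
allFuns zero    xs = (λ ()) ∷ []
allFuns (suc n) xs =
  concatMap (λ a → map (λ g → λ { Fin.zero → a ; (Fin.suc i) → g i }) (allFuns n xs)) xs

IsBijection : ∀ {n} → (Fin n → Fin n) → Set
IsBijection {n} σ = (∀ i j → σ i ≡ σ j → i ≡ j) × (∀ j → ∃ λ i → σ i ≡ j)

isBijection? : ∀ {n} (σ : Fin n → Fin n) → Dec (IsBijection σ)
isBijection? σ =
  all? (λ i → all? (λ j → (σ i ≟ σ j) →-dec (i ≟ j)))
  ×-dec all? (λ j → any? (λ i → σ i ≟ j))

perms : (n : ℕ) → List (Fin n → Fin n)
perms n = filter isBijection? (allFuns n (allFin n))

-- C_r with r = suc k is Fin (suc k) with addition mod r.
_+C_ : ∀ {r} .{{_ : NonZero r}} → Fin r → Fin r → Fin r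
_+C_ {r} s t = (toℕ s ℕ.+ toℕ t) mod r
  where import Data.Nat as ℕ

-- Elements of C_r ≀ S_n : pairs (f , σ), f ∈ Fun([n], C_r), σ ∈ S_n.
wreath : (r n : ℕ) → List ((Fin n → Fin r) × (Fin n → Fin n))
wreath r n = cartesianProduct (allFuns n (allFin r)) (perms n)

act : ∀ {r n} .{{_ : NonZero r}} → (Fin n → Fin r) × (Fin n → Fin n) → Fin r × Fin n → Fin r × Fin n
act (f , σ) (s , m) = (s +C f (σ m)) , σ m

HasFixedPoint : ∀ {r n} .{{_ : NonZero r}} → (Fin n → Fin r) × (Fin n → Fin n) → Set
HasFixedPoint {r} {n} g = ∃ λ (x : Fin r × Fin n) → act g x ≡ x

hasFixedPoint? : ∀ {r n} .{{_ : NonZero r}} (g : (Fin n → Fin r) × (Fin n → Fin n)) → Dec (HasFixedPoint g)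
hasFixedPoint? {r} {n} g with any? {P = λ s → ∃ λ m → act g (s , m) ≡ (s , m)}
                                  (λ s → any? (λ m → ≡-dec _≟_ _≟_ (act g (s , m)) (s , m)))
... | yes (s , m , e) = yes ((s , m) , e)
... | no ¬p = no (λ { ((s , m) , e) → ¬p (s , m , e) })

derangements : (k n : ℕ) → ℕ
derangements k n = length (filter (λ g → ¬? (hasFixedPoint? {suc k} {n} g)) (wreath (suc k) n))

card : ∀ {n} → (Fin n → Bool) → ℕ
card {n} A = length (filter (λ i → Data.Bool._≟_ (A i) true) (allFin n))
  where import Data.Bool

-- r-cyclic arrangements of degree n: pairs (A ⊆ [n], element of C_r ≀ S_|A|).
arrangements : (r n : ℕ) → List (Σ (Fin n → Bool) λ A → (Fin (card A) → Fin r) × (Fin (card A) → Fin (card A)))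
arrangements r n = concatMap (λ A → map (A ,_) (wreath r (card A))) (allFuns n (true ∷ false ∷ []))

-- a(n , r) for r ≠ 0 (value at r = 0 is an irrelevant junk value 0).
a : ℕ → ℤ → ℤ
a n (+ zero)    = + 0
a n (+ (suc k)) = + length (arrangements (suc k) n)
a n -[1+ k ]    = (ℤ.- ℤ.1ℤ) ℤ.^ n ℤ.* + derangements k n

rhs : ℕ → ℤ → ℤ
rhs n r = foldr ℤ._+_ (+ 0) (map (λ k → + ((n C k) Data.Nat.* (k !)) ℤ.* (r ℤ.^ k)) (upTo (suc n)))
  where import Data.Nat

-- Both sides are sums over subsets A ⊆ [n] of r^|A| · |A|!, grouped by |A| = k with multiplicity
-- C(n,k).  For r > 0 this is immediate, as C_r ≀ S_k has r^k · k! elements.  For r = -q < 0, an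
-- element (f , σ) of C_q ≀ S_n has a fixed point iff σ i = i and f i = 0 for some i, so (-1)^n
-- times its derangement indicator is ∏ᵢ ([σ i = i ∧ f i = 0] - 1).  Expanding the product over
-- the set A of factors contributing -1 leaves (-1)^|A| times the indicator that σ and f are
-- trivial outside A; for fixed A there are |A|! such permutations and q^|A| such functions, which
-- gives (-q)^|A| · |A|!.  Permutations fixing a set pointwise are counted as injections with
-- partly prescribed values, choosing one image at a time, which yields a falling factorial.

module Submission where

open import Defs
open import Data.Bool as Bool using (Bool; true; false; if_then_else_)
open import Data.Empty using (⊥-elim)
open import Data.Fin using (Fin; zero; suc; toℕ; punchOut; _≟_)
open import Data.Fin.Properties as Finₚ using (all?; any?; 0≢1+n; suc-injective)
open import Data.Integer as ℤ using (ℤ; +_; -[1+_]; 0ℤ; 1ℤ; -1ℤ; _+_; _*_; -_; _-_; _^_)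
import Data.Integer.Properties as ℤₚ
open import Data.Integer.Tactic.RingSolver using (solve-∀)
open import Data.List using (List; []; _∷_; _++_; map; foldr; filter; length; concatMap; cartesianProduct; allFin; upTo)
import Data.List.Properties as Listₚ
open import Data.Maybe using (Maybe; just; nothing; is-nothing)
open import Data.Nat as ℕ using (ℕ; zero; suc; _!; _≤_)
open import Data.Nat.Combinatorics using (_C_; nCk+nC[k+1]≡[n+1]C[k+1]; k>n⇒nCk≡0)
import Data.Nat.Properties as ℕₚ
open import Data.Nat.DivMod using (_%_; m≡m%n+[m/n]*n; m<n⇒m%n≡m)
open import Data.Nat.Divisibility using (divides; n∣m⇒m%n≡0)
open import Data.Product using (Σ; ∃; _×_; _,_; proj₁; proj₂)
open import Function using (_∘_; id; _⇔_; mk⇔; Equivalence; Injective)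
open import Relation.Nullary using (Dec; yes; no; does; ¬_; _×-dec_; ¬?; contradiction)
open import Relation.Nullary.Decidable using (_→-dec_)
open import Relation.Binary.PropositionalEquality

open Equivalence using (to; from)
open ≡-Reasoning

private
  variable
    X Y Z : Set
    P Q : Set
    m   : ℕ

-- Stated via foldr and map so that Defs.rhs is literally such a sum.
∑ : List X → (X → ℤ) → ℤ
∑ xs f = foldr _+_ 0ℤ (map f xs)

infix 5 ∑
syntax ∑ xs (λ x → e) = ∑[ x ∈ xs ] e

∑-cong : ∀ (xs : List X) {f g : X → ℤ} → (∀ x → f x ≡ g x) → ∑ xs f ≡ ∑ xs g
∑-cong []       f≗g = refl
∑-cong (x ∷ xs) f≗g = cong₂ _+_ (f≗g x) (∑-cong xs f≗g)

∑-zero : ∀ (xs : List X) → ∑[ x ∈ xs ] 0ℤ ≡ 0ℤ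
∑-zero []       = refl
∑-zero (x ∷ xs) = trans (ℤₚ.+-identityˡ _) (∑-zero xs)

∑-++ : ∀ (xs ys : List X) f → ∑ (xs ++ ys) f ≡ ∑ xs f + ∑ ys f
∑-++ []       ys f = sym (ℤₚ.+-identityˡ _)
∑-++ (x ∷ xs) ys f = trans (cong (_+_ (f x)) (∑-++ xs ys f)) (sym (ℤₚ.+-assoc (f x) _ _))

∑-+ : ∀ (xs : List X) f g → ∑[ x ∈ xs ] (f x + g x) ≡ ∑ xs f + ∑ xs g
∑-+ []       f g = refl
∑-+ (x ∷ xs) f g = trans (cong (_+_ (f x + g x)) (∑-+ xs f g)) (interchange (f x) (g x) _ _)
  where interchange : ∀ a b c d → a + b + (c + d) ≡ a + c + (b + d)
        interchange = solve-∀

∑-*ˡ : ∀ (xs : List X) c f → ∑[ x ∈ xs ] c * f x ≡ c * ∑ xs f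
∑-*ˡ []       c f = sym (ℤₚ.*-zeroʳ c)
∑-*ˡ (x ∷ xs) c f = trans (cong (_+_ (c * f x)) (∑-*ˡ xs c f)) (sym (ℤₚ.*-distribˡ-+ c (f x) _))

∑-*ʳ : ∀ (xs : List X) c f → ∑[ x ∈ xs ] f x * c ≡ ∑ xs f * c
∑-*ʳ xs c f = trans (∑-cong xs (λ x → ℤₚ.*-comm (f x) c)) (trans (∑-*ˡ xs c f) (ℤₚ.*-comm c _))

+length≡∑1 : ∀ (xs : List X) → + length xs ≡ ∑[ x ∈ xs ] 1ℤ
+length≡∑1 []       = refl
+length≡∑1 (x ∷ xs) = trans (ℤₚ.pos-+ 1 (length xs)) (cong (_+_ 1ℤ) (+length≡∑1 xs))

∑-map : ∀ (g : X → Y) (xs : List X) f → ∑ (map g xs) f ≡ ∑ xs (f ∘ g)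
∑-map g []       f = refl
∑-map g (x ∷ xs) f = cong (_+_ (f (g x))) (∑-map g xs f)

∑-concatMap : ∀ (g : X → List Y) (xs : List X) f → ∑ (concatMap g xs) f ≡ ∑[ x ∈ xs ] ∑ (g x) f
∑-concatMap g []       f = refl
∑-concatMap g (x ∷ xs) f = trans (∑-++ (g x) _ f) (cong (_+_ (∑ (g x) f)) (∑-concatMap g xs f))

∑-cartesianProduct : ∀ (xs : List X) (ys : List Y) f →
                     ∑ (cartesianProduct xs ys) f ≡ ∑[ x ∈ xs ] ∑[ y ∈ ys ] f (x , y)
∑-cartesianProduct []       ys f = refl
∑-cartesianProduct (x ∷ xs) ys f =
  trans (∑-++ (map (x ,_) ys) _ f) (cong₂ _+_ (∑-map (x ,_) ys f) (∑-cartesianProduct xs ys f))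

∑-comm : ∀ (xs : List X) (ys : List Y) (f : X → Y → ℤ) →
         ∑[ x ∈ xs ] ∑[ y ∈ ys ] f x y ≡ ∑[ y ∈ ys ] ∑[ x ∈ xs ] f x y
∑-comm []       ys f = sym (∑-zero ys)
∑-comm (x ∷ xs) ys f = trans (cong (_+_ (∑ ys (f x))) (∑-comm xs ys f)) (sym (∑-+ ys (f x) _))

∑∑∑-separate : ∀ (xs : List X) (ys : List Y) (zs : List Z) (s : Z → ℤ) (u : Y → Z → ℤ) (v : X → Z → ℤ) →
  ∑[ x ∈ xs ] ∑[ y ∈ ys ] ∑[ z ∈ zs ] s z * (u y z * v x z)
    ≡ ∑[ z ∈ zs ] s z * ((∑[ y ∈ ys ] u y z) * (∑[ x ∈ xs ] v x z))
∑∑∑-separate xs ys zs s u v = begin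
  ∑[ x ∈ xs ] ∑[ y ∈ ys ] ∑[ z ∈ zs ] s z * (u y z * v x z)
    ≡⟨ ∑-cong xs (λ x → ∑-comm ys zs _) ⟩
  ∑[ x ∈ xs ] ∑[ z ∈ zs ] ∑[ y ∈ ys ] s z * (u y z * v x z)
    ≡⟨ ∑-comm xs zs _ ⟩
  ∑[ z ∈ zs ] ∑[ x ∈ xs ] ∑[ y ∈ ys ] s z * (u y z * v x z)
    ≡⟨ ∑-cong zs (λ z → ∑-cong xs (λ x → inner z x)) ⟩
  ∑[ z ∈ zs ] ∑[ x ∈ xs ] (s z * (∑[ y ∈ ys ] u y z)) * v x z
    ≡⟨ ∑-cong zs (λ z → trans (∑-*ˡ xs (s z * (∑[ y ∈ ys ] u y z)) (λ x → v x z)) (ℤₚ.*-assoc (s z) _ _)) ⟩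
  ∑[ z ∈ zs ] s z * ((∑[ y ∈ ys ] u y z) * (∑[ x ∈ xs ] v x z)) ∎
  where
  inner : ∀ z x → ∑[ y ∈ ys ] s z * (u y z * v x z) ≡ (s z * (∑[ y ∈ ys ] u y z)) * v x z
  inner z x = begin
    ∑[ y ∈ ys ] s z * (u y z * v x z)       ≡⟨ ∑-cong ys (λ y → sym (ℤₚ.*-assoc (s z) (u y z) (v x z))) ⟩
    ∑[ y ∈ ys ] s z * u y z * v x z         ≡⟨ ∑-*ʳ ys (v x z) (λ y → s z * u y z) ⟩
    (∑[ y ∈ ys ] s z * u y z) * v x z       ≡⟨ cong (_* v x z) (∑-*ˡ ys (s z) (λ y → u y z)) ⟩
    (s z * (∑[ y ∈ ys ] u y z)) * v x z     ∎

𝟙 : Dec P → ℤ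
𝟙 d = if does d then 1ℤ else 0ℤ

𝟙-yes : P → (d : Dec P) → 𝟙 d ≡ 1ℤ
𝟙-yes p (yes _) = refl
𝟙-yes p (no ¬p) = ⊥-elim (¬p p)

𝟙-no : ¬ P → (d : Dec P) → 𝟙 d ≡ 0ℤ
𝟙-no ¬p (yes p) = ⊥-elim (¬p p)
𝟙-no ¬p (no _)  = refl

𝟙-cong : P ⇔ Q → (d : Dec P) (e : Dec Q) → 𝟙 d ≡ 𝟙 e
𝟙-cong P⇔Q (yes p) e = sym (𝟙-yes (to P⇔Q p) e)
𝟙-cong P⇔Q (no ¬p) e = sym (𝟙-no (¬p ∘ from P⇔Q) e)

𝟙-× : (d : Dec P) (e : Dec Q) → 𝟙 (d ×-dec e) ≡ 𝟙 d * 𝟙 e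
𝟙-× (yes _) (yes _) = refl
𝟙-× (yes _) (no _)  = refl
𝟙-× (no _)  e       = sym (ℤₚ.*-zeroˡ (𝟙 e))

𝟙-¬ : (d : Dec P) → 𝟙 (¬? d) ≡ 1ℤ - 𝟙 d
𝟙-¬ (yes _) = refl
𝟙-¬ (no _)  = refl

𝟙-*-cong : ∀ {x y} → (P → x ≡ y) → (d : Dec P) → 𝟙 d * x ≡ 𝟙 d * y
𝟙-*-cong x≡y (yes p) = cong (1ℤ *_) (x≡y p)
𝟙-*-cong {x = x} {y = y} x≡y (no _) = trans (ℤₚ.*-zeroˡ x) (sym (ℤₚ.*-zeroˡ y))

∑-filter : ∀ {P : X → Set} (P? : ∀ x → Dec (P x)) (xs : List X) f →
           ∑ (filter P? xs) f ≡ ∑[ x ∈ xs ] 𝟙 (P? x) * f x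
∑-filter P? []       f = refl
∑-filter P? (x ∷ xs) f with does (P? x)
... | true  = cong₂ _+_ (sym (ℤₚ.*-identityˡ (f x))) (∑-filter P? xs f)
... | false = trans (∑-filter P? xs f) (sym (ℤₚ.+-identityˡ (∑[ y ∈ xs ] 𝟙 (P? y) * f y)))

+length-filter : ∀ {P : X → Set} (P? : ∀ x → Dec (P x)) (xs : List X) →
                 + length (filter P? xs) ≡ ∑[ x ∈ xs ] 𝟙 (P? x)
+length-filter P? xs =
  trans (+length≡∑1 (filter P? xs))
        (trans (∑-filter P? xs (λ _ → 1ℤ)) (∑-cong xs (λ x → ℤₚ.*-identityʳ (𝟙 (P? x)))))

∏ᶠ : ∀ {n} → (Fin n → ℤ) → ℤ
∏ᶠ {zero}  f = 1ℤ
∏ᶠ {suc n} f = f zero * ∏ᶠ (f ∘ suc)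

∏ᶠ-cong : ∀ {n} {f g : Fin n → ℤ} → (∀ i → f i ≡ g i) → ∏ᶠ f ≡ ∏ᶠ g
∏ᶠ-cong {zero}  f≗g = refl
∏ᶠ-cong {suc n} f≗g = cong₂ _*_ (f≗g zero) (∏ᶠ-cong (f≗g ∘ suc))

∏ᶠ-* : ∀ {n} (f g : Fin n → ℤ) → ∏ᶠ (λ i → f i * g i) ≡ ∏ᶠ f * ∏ᶠ g
∏ᶠ-* {zero}  f g = refl
∏ᶠ-* {suc n} f g = trans (cong (f zero * g zero *_) (∏ᶠ-* (f ∘ suc) (g ∘ suc)))
                         (interchange (f zero) (g zero) _ _)
  where interchange : ∀ a b c d → a * b * (c * d) ≡ a * c * (b * d)
        interchange = solve-∀

∏ᶠ-const : ∀ n x → ∏ᶠ {n} (λ _ → x) ≡ x ^ n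
∏ᶠ-const zero    x = refl
∏ᶠ-const (suc n) x = cong (x *_) (∏ᶠ-const n x)

-1^n*x^n≡[-x]^n : ∀ x n → -1ℤ ^ n * x ^ n ≡ (- x) ^ n
-1^n*x^n≡[-x]^n x zero    = refl
-1^n*x^n≡[-x]^n x (suc n) = trans (shuffle (-1ℤ ^ n) (x ^ n) x) (cong (- x *_) (-1^n*x^n≡[-x]^n x n))
  where shuffle : ∀ u v x → (-1ℤ * u) * (x * v) ≡ - x * (u * v)
        shuffle = solve-∀

trues : ∀ {n} → (Fin n → Bool) → ℕ
trues {zero}  A = 0
trues {suc n} A = (if A zero then 1 else 0) ℕ.+ trues (A ∘ suc)

trues-const-true : ∀ n → trues {n} (λ _ → true) ≡ n
trues-const-true zero    = refl
trues-const-true (suc n) = cong suc (trues-const-true n)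

trues-cong : ∀ {n} {A B : Fin n → Bool} → (∀ i → A i ≡ B i) → trues A ≡ trues B
trues-cong {zero}  A≗B = refl
trues-cong {suc n} A≗B = cong₂ (λ b t → (if b then 1 else 0) ℕ.+ t) (A≗B zero) (trues-cong (A≗B ∘ suc))

∏ᶠ-if : ∀ {n} (A : Fin n → Bool) x → ∏ᶠ (λ i → if A i then x else 1ℤ) ≡ x ^ trues A
∏ᶠ-if {zero}  A x = refl
∏ᶠ-if {suc n} A x with A zero
... | true  = cong (x *_) (∏ᶠ-if (A ∘ suc) x)
... | false = trans (ℤₚ.*-identityˡ _) (∏ᶠ-if (A ∘ suc) x)

𝟙-∀ : ∀ {n} {Q : Fin n → Set} (d : Dec (∀ i → Q i)) (Q? : ∀ i → Dec (Q i)) →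
      𝟙 d ≡ ∏ᶠ (λ i → 𝟙 (Q? i))
𝟙-∀ {zero}  d Q? = 𝟙-yes (λ ()) d
𝟙-∀ {suc n} {Q} d Q? = begin
  𝟙 d                                ≡⟨ 𝟙-cong head∧tail d (Q? zero ×-dec all? (Q? ∘ suc)) ⟩
  𝟙 (Q? zero ×-dec all? (Q? ∘ suc))  ≡⟨ 𝟙-× (Q? zero) (all? (Q? ∘ suc)) ⟩
  𝟙 (Q? zero) * 𝟙 (all? (Q? ∘ suc)) ≡⟨ cong (𝟙 (Q? zero) *_) (𝟙-∀ (all? (Q? ∘ suc)) (Q? ∘ suc)) ⟩
  ∏ᶠ (λ i → 𝟙 (Q? i))                ∎
  where
  head∧tail : (∀ i → Q i) ⇔ (Q zero × (∀ i → Q (suc i)))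
  head∧tail = mk⇔ (λ q → q zero , q ∘ suc) λ { (q₀ , q₊) zero → q₀ ; (q₀ , q₊) (suc i) → q₊ i }

∑-allFin-suc : ∀ {m} (f : Fin (suc m) → ℤ) → ∑ (allFin (suc m)) f ≡ f zero + ∑ (allFin m) (f ∘ suc)
∑-allFin-suc f = cong (_+_ (f zero) ∘ foldr _+_ 0ℤ)
                      (trans (Listₚ.map-tabulate suc f) (sym (Listₚ.map-tabulate id (f ∘ suc))))

∑-allFin-1 : ∀ m → ∑[ y ∈ allFin m ] 1ℤ ≡ + m
∑-allFin-1 m = trans (sym (+length≡∑1 (allFin m))) (cong +_ (Listₚ.length-tabulate id))

∑-allFin-δ : ∀ {m} (b : Fin m) (X : Fin m → ℤ) → ∑[ y ∈ allFin m ] 𝟙 (y ≟ b) * X y ≡ X b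
∑-allFin-δ {suc m} zero X = begin
  ∑[ y ∈ allFin (suc m) ] 𝟙 (y ≟ zero) * X y ≡⟨ ∑-allFin-suc (λ y → 𝟙 (y ≟ zero) * X y) ⟩
  1ℤ * X zero + (∑[ y ∈ allFin m ] 0ℤ * X (suc y))
    ≡⟨ cong₂ _+_ (ℤₚ.*-identityˡ (X zero)) (trans (∑-cong (allFin m) (ℤₚ.*-zeroˡ ∘ X ∘ suc)) (∑-zero (allFin m))) ⟩
  X zero + 0ℤ                                ≡⟨ ℤₚ.+-identityʳ (X zero) ⟩
  X zero                                     ∎
∑-allFin-δ {suc m} (suc b) X = begin
  ∑[ y ∈ allFin (suc m) ] 𝟙 (y ≟ suc b) * X y   ≡⟨ ∑-allFin-suc (λ y → 𝟙 (y ≟ suc b) * X y) ⟩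
  0ℤ * X zero + (∑[ y ∈ allFin m ] 𝟙 (y ≟ b) * X (suc y))       ≡⟨ ℤₚ.+-identityˡ _ ⟩
  ∑[ y ∈ allFin m ] 𝟙 (y ≟ b) * X (suc y)                     ≡⟨ ∑-allFin-δ b (X ∘ suc) ⟩
  X (suc b)                                                   ∎

+trues≡∑ : ∀ {n} (A : Fin n → Bool) → + trues A ≡ ∑[ i ∈ allFin n ] 𝟙 (A i Bool.≟ true)
+trues≡∑ {zero}  A = refl
+trues≡∑ {suc n} A = begin
  + trues A                                          ≡⟨ ℤₚ.pos-+ _ (trues (A ∘ suc)) ⟩
  + (if A zero then 1 else 0) + + trues (A ∘ suc)    ≡⟨ cong₂ _+_ (indicator (A zero)) (+trues≡∑ (A ∘ suc)) ⟩
  𝟙 (A zero Bool.≟ true) + (∑[ i ∈ allFin n ] 𝟙 (A (suc i) Bool.≟ true))≡⟨ sym (∑-allFin-suc (λ i → 𝟙 (A i Bool.≟ true))) ⟩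
  ∑[ i ∈ allFin (suc n) ] 𝟙 (A i Bool.≟ true)        ∎
  where
  indicator : ∀ b → + (if b then 1 else 0) ≡ 𝟙 (b Bool.≟ true)
  indicator true  = refl
  indicator false = refl

card≡trues : ∀ {n} (A : Fin n → Bool) → card A ≡ trues A
card≡trues {n} A = ℤₚ.+-injective (trans (+length-filter (λ i → A i Bool.≟ true) (allFin n)) (sym (+trues≡∑ A)))

∑-allFuns-suc : ∀ {n} (xs : List X) (H : X → (Fin n → X) → ℤ) →
                ∑[ g ∈ allFuns (suc n) xs ] H (g zero) (g ∘ suc) ≡ ∑[ x ∈ xs ] ∑[ h ∈ allFuns n xs ] H x h
∑-allFuns-suc {n = n} xs H = trans (∑-concatMap _ xs _) (∑-cong xs (λ x → ∑-map _ (allFuns n xs) _))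

∑-allFuns-∏ : ∀ n (xs : List X) (w : Fin n → X → ℤ) →
              ∑[ g ∈ allFuns n xs ] ∏ᶠ (λ i → w i (g i)) ≡ ∏ᶠ (λ i → ∑ xs (w i))
∑-allFuns-∏ zero    xs w = refl
∑-allFuns-∏ (suc n) xs w = begin
  ∑[ g ∈ allFuns (suc n) xs ] w zero (g zero) * ∏ᶠ (λ i → w (suc i) (g (suc i)))
    ≡⟨ ∑-allFuns-suc xs (λ x h → w zero x * ∏ᶠ (λ i → w (suc i) (h i))) ⟩
  ∑[ x ∈ xs ] ∑[ h ∈ allFuns n xs ] w zero x * ∏ᶠ (λ i → w (suc i) (h i))
    ≡⟨ ∑-cong xs (λ x → ∑-*ˡ (allFuns n xs) (w zero x) _) ⟩
  ∑[ x ∈ xs ] w zero x * (∑[ h ∈ allFuns n xs ] ∏ᶠ (λ i → w (suc i) (h i)))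
    ≡⟨ ∑-*ʳ xs _ (w zero) ⟩
  ∑ xs (w zero) * (∑[ h ∈ allFuns n xs ] ∏ᶠ (λ i → w (suc i) (h i)))
    ≡⟨ cong (∑ xs (w zero) *_) (∑-allFuns-∏ n xs (w ∘ suc)) ⟩
  ∏ᶠ (λ i → ∑ xs (w i)) ∎

-- Counting injections with prescribed values

infixr 8 _↓_

_↓_ : ℤ → ℕ → ℤ
x ↓ zero  = 1ℤ
x ↓ suc k = x * (x - 1ℤ) ↓ k

+n↓n≡n! : ∀ n → (+ n) ↓ n ≡ + (n !)
+n↓n≡n! zero    = refl
+n↓n≡n! (suc n) = trans (cong (+ suc n *_) (+n↓n≡n! n)) (sym (ℤₚ.pos-* (suc n) (n !)))

remove : (Fin m → Bool) → Fin m → Fin m → Bool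
remove V y x = if does (x ≟ y) then false else V x

remove-true : ∀ (V : Fin m → Bool) y x → remove V y x ≡ true ⇔ (V x ≡ true × x ≢ y)
remove-true V y x with x ≟ y
... | yes refl = mk⇔ (λ ()) (λ (_ , x≢x) → contradiction refl x≢x)
... | no  x≢y  = mk⇔ (_, x≢y) proj₁

remove-false : ∀ (V : Fin m → Bool) y x → V x ≡ false → remove V y x ≡ false
remove-false V y x Vx≡false with x ≟ y
... | yes _ = refl
... | no  _ = Vx≡false

+trues-remove : ∀ (V : Fin m → Bool) y → + trues V ≡ + trues (remove V y) + 𝟙 (V y Bool.≟ true)
+trues-remove {m} V y = begin
  + trues V                                                         ≡⟨ +trues≡∑ V ⟩
  ∑[ x ∈ allFin m ] 𝟙 (V x Bool.≟ true)                             ≡⟨ ∑-cong (allFin m) split ⟩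
  ∑[ x ∈ allFin m ] (𝟙 (remove V y x Bool.≟ true) + 𝟙 (x ≟ y) * 𝟙 (V x Bool.≟ true))
    ≡⟨ ∑-+ (allFin m) _ _ ⟩
  (∑[ x ∈ allFin m ] 𝟙 (remove V y x Bool.≟ true)) + (∑[ x ∈ allFin m ] 𝟙 (x ≟ y) * 𝟙 (V x Bool.≟ true))
    ≡⟨ cong₂ _+_ (sym (+trues≡∑ (remove V y))) (∑-allFin-δ y (λ x → 𝟙 (V x Bool.≟ true))) ⟩
  + trues (remove V y) + 𝟙 (V y Bool.≟ true)                        ∎
  where
  split : ∀ x → 𝟙 (V x Bool.≟ true) ≡ 𝟙 (remove V y x Bool.≟ true) + 𝟙 (x ≟ y) * 𝟙 (V x Bool.≟ true)
  split x with x ≟ y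
  ... | yes _ = sym (trans (ℤₚ.+-identityˡ _) (ℤₚ.*-identityˡ _))
  ... | no  _ = sym (trans (cong (_+_ (𝟙 (V x Bool.≟ true))) (ℤₚ.*-zeroˡ (𝟙 (V x Bool.≟ true)))) (ℤₚ.+-identityʳ _))

+trues-remove-false : ∀ (V : Fin m → Bool) y → V y ≡ false → + trues (remove V y) ≡ + trues V
+trues-remove-false V y Vy≡false = sym (begin
  + trues V                                   ≡⟨ +trues-remove V y ⟩
  + trues (remove V y) + 𝟙 (V y Bool.≟ true)  ≡⟨ cong (λ b → + trues (remove V y) + 𝟙 (b Bool.≟ true)) Vy≡false ⟩
  + trues (remove V y) + 0ℤ                   ≡⟨ ℤₚ.+-identityʳ _ ⟩
  + trues (remove V y)                        ∎)

+trues-remove-true : ∀ (V : Fin m → Bool) y → V y ≡ true → + trues (remove V y) ≡ + trues V - 1ℤ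
+trues-remove-true V y Vy≡true = begin
  + trues (remove V y)                        ≡⟨ +1-1 (+ trues (remove V y)) ⟩
  + trues (remove V y) + 1ℤ - 1ℤ              ≡⟨ cong (λ b → + trues (remove V y) + 𝟙 (b Bool.≟ true) - 1ℤ) (sym Vy≡true) ⟩
  + trues (remove V y) + 𝟙 (V y Bool.≟ true) - 1ℤ ≡⟨ cong (_- 1ℤ) (sym (+trues-remove V y)) ⟩
  + trues V - 1ℤ                              ∎
  where +1-1 : ∀ x → x ≡ x + 1ℤ - 1ℤ
        +1-1 = solve-∀

-- p i ≡ just b prescribes the value b at position i; a free position (p i ≡ nothing) must take a
-- value in V, the values still available.
Fits : Maybe (Fin m) → (Fin m → Bool) → Fin m → Set
Fits (just b) V y = y ≡ b
Fits nothing  V y = V y ≡ true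

fits? : ∀ (c : Maybe (Fin m)) V y → Dec (Fits c V y)
fits? (just b) V y = y ≟ b
fits? nothing  V y = V y Bool.≟ true

Admissible : ∀ {n} → (Fin n → Maybe (Fin m)) → (Fin m → Bool) → (Fin n → Fin m) → Set
Admissible p V g = (∀ i j → g i ≡ g j → i ≡ j) × (∀ i → Fits (p i) V (g i))

admissible? : ∀ {n} (p : Fin n → Maybe (Fin m)) V g → Dec (Admissible p V g)
admissible? p V g = all? (λ i → all? (λ j → (g i ≟ g j) →-dec (i ≟ j))) ×-dec all? (λ i → fits? (p i) V (g i))

record Consistent {n} (p : Fin n → Maybe (Fin m)) (V : Fin m → Bool) : Set where
  field
    prescribed-unavailable : ∀ i b → p i ≡ just b → V b ≡ false
    prescriptions-distinct : ∀ i j b → p i ≡ just b → p j ≡ just b → i ≡ j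

open Consistent

free : ∀ {n} → (Fin n → Maybe (Fin m)) → ℕ
free p = trues (is-nothing ∘ p)

consistent-tail : ∀ {n} {p : Fin (suc n) → Maybe (Fin m)} {V} → Consistent p V →
                  ∀ y → Consistent (p ∘ suc) (remove V y)
consistent-tail {V = V} c y = record
  { prescribed-unavailable = λ i b eq → remove-false V y b (prescribed-unavailable c (suc i) b eq)
  ; prescriptions-distinct = λ i j b eqᵢ eqⱼ → suc-injective (prescriptions-distinct c (suc i) (suc j) b eqᵢ eqⱼ)
  }

fits-remove : ∀ (c : Maybe (Fin m)) {V y z} → Fits c V z → z ≢ y → Fits c (remove V y) z
fits-remove (just b)         fits _   = fits
fits-remove nothing {V} {y} {z} fits z≢y = from (remove-true V y z) (fits , z≢y)

fits-unremove : ∀ (c : Maybe (Fin m)) {V y z} → Fits c (remove V y) z → Fits c V z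
fits-unremove (just b)         fits = fits
fits-unremove nothing {V} {y} {z} fits = proj₁ (to (remove-true V y z) fits)

-- A later free position avoids y because y was removed; a later prescribed value differs from y
-- by consistency.
fits-separated : ∀ {n} {p : Fin (suc n) → Maybe (Fin m)} {V y z} → Consistent p V → ∀ j →
                 Fits (p zero) V y → Fits (p (suc j)) (remove V y) z → z ≢ y
fits-separated {p = p} {V} {y} {z} c j fits₀ fitsⱼ with p zero in eq₀ | p (suc j) in eqⱼ
... | _      | nothing = proj₂ (to (remove-true V y z) fitsⱼ)
... | just b | just b′ = λ z≡y → 0≢1+n (prescriptions-distinct c zero (suc j) b eq₀
                                   (trans eqⱼ (cong just (trans (sym fitsⱼ) (trans z≡y fits₀)))))
... | nothing | just b′ = λ z≡y → contradiction
        (trans (sym fits₀) (trans (cong V (trans (sym z≡y) fitsⱼ)) (prescribed-unavailable c (suc j) b′ eqⱼ)))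
        λ ()

admissible-suc : ∀ {n} {p : Fin (suc n) → Maybe (Fin m)} {V} → Consistent p V → ∀ g →
                 Admissible p V g ⇔ (Fits (p zero) V (g zero) × Admissible (p ∘ suc) (remove V (g zero)) (g ∘ suc))
admissible-suc {p = p} {V} c g = mk⇔ split join
  where
  split : Admissible p V g → Fits (p zero) V (g zero) × Admissible (p ∘ suc) (remove V (g zero)) (g ∘ suc)
  split (inj , fits) = fits zero
                     , (λ i j eq → suc-injective (inj (suc i) (suc j) eq))
                     , (λ i → fits-remove (p (suc i)) (fits (suc i)) (λ eq → 0≢1+n (inj zero (suc i) (sym eq))))

  join : Fits (p zero) V (g zero) × Admissible (p ∘ suc) (remove V (g zero)) (g ∘ suc) → Admissible p V g
  join (fits₀ , inj₊ , fits₊) = inj , fits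
    where
    inj : ∀ i j → g i ≡ g j → i ≡ j
    inj zero    zero    _  = refl
    inj zero    (suc j) eq = contradiction (sym eq) (fits-separated c j fits₀ (fits₊ j))
    inj (suc i) zero    eq = contradiction eq (fits-separated c i fits₀ (fits₊ i))
    inj (suc i) (suc j) eq = cong suc (inj₊ i j eq)

    fits : ∀ i → Fits (p i) V (g i)
    fits zero    = fits₀
    fits (suc i) = fits-unremove (p (suc i)) (fits₊ i)

𝟙-admissible-suc : ∀ {n} {p : Fin (suc n) → Maybe (Fin m)} {V} → Consistent p V → ∀ g →
                   𝟙 (admissible? p V g)
                     ≡ 𝟙 (fits? (p zero) V (g zero)) * 𝟙 (admissible? (p ∘ suc) (remove V (g zero)) (g ∘ suc))
𝟙-admissible-suc {p = p} {V} c g = begin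
  𝟙 (admissible? p V g)                                      ≡⟨ 𝟙-cong (admissible-suc c g) (admissible? p V g) (fits₀? ×-dec rest?) ⟩
  𝟙 (fits₀? ×-dec rest?)                                     ≡⟨ 𝟙-× fits₀? rest? ⟩
  𝟙 fits₀? * 𝟙 rest?                                          ∎
  where
  fits₀? : Dec (Fits (p zero) V (g zero))
  fits₀? = fits? (p zero) V (g zero)

  rest? : Dec (Admissible (p ∘ suc) (remove V (g zero)) (g ∘ suc))
  rest? = admissible? (p ∘ suc) (remove V (g zero)) (g ∘ suc)

∑-fits : ∀ k (c : Maybe (Fin m)) V → (∀ b → c ≡ just b → V b ≡ false) →
         ∑[ y ∈ allFin m ] 𝟙 (fits? c V y) * (+ trues (remove V y)) ↓ k
           ≡ (+ trues V) ↓ ((if is-nothing c then 1 else 0) ℕ.+ k)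
∑-fits {m} k (just b) V unavailable = begin
  ∑[ y ∈ allFin m ] 𝟙 (y ≟ b) * (+ trues (remove V y)) ↓ k ≡⟨ ∑-allFin-δ b (λ y → (+ trues (remove V y)) ↓ k) ⟩
  (+ trues (remove V b)) ↓ k                                ≡⟨ cong (_↓ k) (+trues-remove-false V b (unavailable b refl)) ⟩
  (+ trues V) ↓ k                                           ∎
∑-fits {m} k nothing V _ = begin
  ∑[ y ∈ allFin m ] 𝟙 (V y Bool.≟ true) * (+ trues (remove V y)) ↓ k
    ≡⟨ ∑-cong (allFin m) (λ y → 𝟙-*-cong (λ Vy≡true → cong (_↓ k) (+trues-remove-true V y Vy≡true)) (V y Bool.≟ true)) ⟩
  ∑[ y ∈ allFin m ] 𝟙 (V y Bool.≟ true) * (+ trues V - 1ℤ) ↓ k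
    ≡⟨ ∑-*ʳ (allFin m) ((+ trues V - 1ℤ) ↓ k) (λ y → 𝟙 (V y Bool.≟ true)) ⟩
  (∑[ y ∈ allFin m ] 𝟙 (V y Bool.≟ true)) * (+ trues V - 1ℤ) ↓ k
    ≡⟨ cong (_* (+ trues V - 1ℤ) ↓ k) (sym (+trues≡∑ V)) ⟩
  (+ trues V) ↓ suc k ∎

∑-admissible : ∀ {n} (p : Fin n → Maybe (Fin m)) V → Consistent p V →
               ∑[ g ∈ allFuns n (allFin m) ] 𝟙 (admissible? p V g) ≡ (+ trues V) ↓ free p
∑-admissible {n = zero} p V _ = trans (ℤₚ.+-identityʳ _) (𝟙-yes ((λ ()) , (λ ())) (admissible? p V (λ ())))
∑-admissible {m} {suc n} p V c = begin
  ∑[ g ∈ allFuns (suc n) (allFin m) ] 𝟙 (admissible? p V g)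
    ≡⟨ ∑-cong (allFuns (suc n) (allFin m)) (𝟙-admissible-suc c) ⟩
  ∑[ g ∈ allFuns (suc n) (allFin m) ] 𝟙 (fits? (p zero) V (g zero)) * 𝟙 (admissible? (p ∘ suc) (remove V (g zero)) (g ∘ suc))
    ≡⟨ ∑-allFuns-suc (allFin m) (λ y h → 𝟙 (fits? (p zero) V y) * 𝟙 (admissible? (p ∘ suc) (remove V y) h)) ⟩
  ∑[ y ∈ allFin m ] ∑[ h ∈ allFuns n (allFin m) ] 𝟙 (fits? (p zero) V y) * 𝟙 (admissible? (p ∘ suc) (remove V y) h)
    ≡⟨ ∑-cong (allFin m) (λ y → ∑-*ˡ (allFuns n (allFin m)) (𝟙 (fits? (p zero) V y)) (𝟙 ∘ admissible? (p ∘ suc) (remove V y))) ⟩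
  ∑[ y ∈ allFin m ] 𝟙 (fits? (p zero) V y) * (∑[ h ∈ allFuns n (allFin m) ] 𝟙 (admissible? (p ∘ suc) (remove V y) h))
    ≡⟨ ∑-cong (allFin m) (λ y → cong (𝟙 (fits? (p zero) V y) *_)
                                     (∑-admissible (p ∘ suc) (remove V y) (consistent-tail c y))) ⟩
  ∑[ y ∈ allFin m ] 𝟙 (fits? (p zero) V y) * (+ trues (remove V y)) ↓ free (p ∘ suc)
    ≡⟨ ∑-fits (free (p ∘ suc)) (p zero) V (prescribed-unavailable c zero) ⟩
  (+ trues V) ↓ free p ∎

-- Permutations and functions agreeing with a given one outside a subset

injective⇒surjective : ∀ {n} (σ : Fin n → Fin n) → (∀ i j → σ i ≡ σ j → i ≡ j) → ∀ y → ∃ λ i → σ i ≡ y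
injective⇒surjective {suc n} σ inj y with any? (λ i → σ i ≟ y)
... | yes hit  = hit
... | no  miss = contradiction (Finₚ.injective⇒≤ punched-injective) ℕₚ.1+n≰n
  where
  y≢σ : ∀ i → y ≢ σ i
  y≢σ i y≡σi = miss (i , sym y≡σi)

  punched : Fin (suc n) → Fin n
  punched i = punchOut (y≢σ i)

  punched-injective : Injective _≡_ _≡_ punched
  punched-injective {i} {j} eq = inj i j (Finₚ.punchOut-injective (y≢σ i) (y≢σ j) eq)

AgreesOutside : ∀ {n} → (Fin n → Bool) → (Fin n → Fin m) → (Fin n → Fin m) → Set
AgreesOutside A g c = ∀ i → A i ≡ false → g i ≡ c i

agreesOutside? : ∀ {n} (A : Fin n → Bool) (g c : Fin n → Fin m) → Dec (AgreesOutside A g c)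
agreesOutside? A g c = all? (λ i → (A i Bool.≟ false) →-dec (g i ≟ c i))

∑-agreesOutside : ∀ {n} (A : Fin n → Bool) (c : Fin n → Fin m) →
                  ∑[ g ∈ allFuns n (allFin m) ] 𝟙 (agreesOutside? A g c) ≡ (+ m) ^ trues A
∑-agreesOutside {m} {n} A c = begin
  ∑[ g ∈ allFuns n (allFin m) ] 𝟙 (agreesOutside? A g c)
    ≡⟨ ∑-cong (allFuns n (allFin m)) (λ g → 𝟙-∀ (agreesOutside? A g c) (λ i → agreesAt i (g i))) ⟩
  ∑[ g ∈ allFuns n (allFin m) ] ∏ᶠ (λ i → 𝟙 (agreesAt i (g i)))
    ≡⟨ ∑-allFuns-∏ n (allFin m) (λ i y → 𝟙 (agreesAt i y)) ⟩
  ∏ᶠ (λ i → ∑[ y ∈ allFin m ] 𝟙 (agreesAt i y))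
    ≡⟨ ∏ᶠ-cong column ⟩
  ∏ᶠ (λ i → if A i then + m else 1ℤ)
    ≡⟨ ∏ᶠ-if A (+ m) ⟩
  (+ m) ^ trues A ∎
  where
  agreesAt : ∀ i y → Dec (A i ≡ false → y ≡ c i)
  agreesAt i y = (A i Bool.≟ false) →-dec (y ≟ c i)

  column : ∀ i → ∑[ y ∈ allFin m ] 𝟙 (agreesAt i y) ≡ (if A i then + m else 1ℤ)
  column i with A i
  ... | true  = ∑-allFin-1 m
  ... | false = trans (∑-cong (allFin m) (λ y → sym (ℤₚ.*-identityʳ (𝟙 (y ≟ c i))))) (∑-allFin-δ (c i) (λ _ → 1ℤ))

+length-allFuns : ∀ n (xs : List X) → + length (allFuns n xs) ≡ (+ length xs) ^ n
+length-allFuns n xs = begin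
  + length (allFuns n xs)                        ≡⟨ +length≡∑1 (allFuns n xs) ⟩
  ∑[ g ∈ allFuns n xs ] 1ℤ                        ≡⟨ ∑-cong (allFuns n xs) (λ _ → sym (∏ᶠ-1 n)) ⟩
  ∑[ g ∈ allFuns n xs ] ∏ᶠ {n} (λ _ → 1ℤ)          ≡⟨ ∑-allFuns-∏ n xs (λ _ _ → 1ℤ) ⟩
  ∏ᶠ {n} (λ _ → ∑[ x ∈ xs ] 1ℤ)                   ≡⟨ ∏ᶠ-const n _ ⟩
  (∑[ x ∈ xs ] 1ℤ) ^ n                            ≡⟨ cong (_^ n) (sym (+length≡∑1 xs)) ⟩
  (+ length xs) ^ n                               ∎
  where
  ∏ᶠ-1 : ∀ n → ∏ᶠ {n} (λ _ → 1ℤ) ≡ 1ℤ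
  ∏ᶠ-1 n = trans (∏ᶠ-const n 1ℤ) (ℤₚ.^-zeroˡ n)

fixOutside : ∀ {n} → (Fin n → Bool) → Fin n → Maybe (Fin n)
fixOutside A i = if A i then nothing else just i

fixOutside-just : ∀ {n} (A : Fin n → Bool) i b → fixOutside A i ≡ just b → A i ≡ false × i ≡ b
fixOutside-just A i b eq with A i
fixOutside-just A i b ()   | true
fixOutside-just A i b refl | false = refl , refl

free-fixOutside : ∀ {n} (A : Fin n → Bool) → free (fixOutside A) ≡ trues A
free-fixOutside A = trues-cong λ i → is-nothing-if (A i)
  where is-nothing-if : ∀ b {i} → is-nothing (if b then nothing else just i) ≡ b
        is-nothing-if true  = refl
        is-nothing-if false = refl

consistent-fixOutside : ∀ {n} (A : Fin n → Bool) → Consistent (fixOutside A) A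
consistent-fixOutside A = record
  { prescribed-unavailable = λ i b eq → let (Ai≡false , i≡b) = fixOutside-just A i b eq
                                         in subst (λ j → A j ≡ false) i≡b Ai≡false
  ; prescriptions-distinct = λ i j b eqᵢ eqⱼ → trans (proj₂ (fixOutside-just A i b eqᵢ))
                                                     (sym (proj₂ (fixOutside-just A j b eqⱼ)))
  }

-- A bijection fixing every point outside A maps A into A, which is what admissibility demands.
bijection-fixing⇔admissible : ∀ {n} (A : Fin n → Bool) σ →
                              (IsBijection σ × AgreesOutside A σ id) ⇔ Admissible (fixOutside A) A σ
bijection-fixing⇔admissible A σ = mk⇔ forward backward
  where
  forward : IsBijection σ × AgreesOutside A σ id → Admissible (fixOutside A) A σ
  forward ((inj , _) , fixed) = inj , fits
    where
    fits : ∀ i → Fits (fixOutside A i) A (σ i)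
    fits i with A i in Ai
    ... | false = fixed i Ai
    ... | true with A (σ i) in Aσi
    ...   | true  = refl
    ...   | false = contradiction (trans (sym Ai) (trans (cong A (sym (inj (σ i) i (fixed (σ i) Aσi)))) Aσi)) λ ()

  backward : Admissible (fixOutside A) A σ → IsBijection σ × AgreesOutside A σ id
  backward (inj , fits) = (inj , injective⇒surjective σ inj)
                        , λ i Ai≡false → subst (λ b → Fits (if b then nothing else just i) A (σ i)) Ai≡false (fits i)

∑-perms-agreesOutside : ∀ n (A : Fin n → Bool) → ∑[ σ ∈ perms n ] 𝟙 (agreesOutside? A σ id) ≡ + (trues A !)
∑-perms-agreesOutside n A = begin
  ∑[ σ ∈ perms n ] 𝟙 (agreesOutside? A σ id)
    ≡⟨ ∑-filter isBijection? (allFuns n (allFin n)) _ ⟩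
  ∑[ σ ∈ allFuns n (allFin n) ] 𝟙 (isBijection? σ) * 𝟙 (agreesOutside? A σ id)
    ≡⟨ ∑-cong (allFuns n (allFin n)) (λ σ → sym (𝟙-× (isBijection? σ) (agreesOutside? A σ id))) ⟩
  ∑[ σ ∈ allFuns n (allFin n) ] 𝟙 (isBijection? σ ×-dec agreesOutside? A σ id)
    ≡⟨ ∑-cong (allFuns n (allFin n)) (λ σ → 𝟙-cong (bijection-fixing⇔admissible A σ)
                                                   (isBijection? σ ×-dec agreesOutside? A σ id)
                                                   (admissible? (fixOutside A) A σ)) ⟩
  ∑[ σ ∈ allFuns n (allFin n) ] 𝟙 (admissible? (fixOutside A) A σ)
    ≡⟨ ∑-admissible (fixOutside A) A (consistent-fixOutside A) ⟩
  (+ trues A) ↓ free (fixOutside A)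
    ≡⟨ cong ((+ trues A) ↓_) (free-fixOutside A) ⟩
  (+ trues A) ↓ trues A
    ≡⟨ +n↓n≡n! (trues A) ⟩
  + (trues A !) ∎

+length-perms : ∀ n → + length (perms n) ≡ + (n !)
+length-perms n = begin
  + length (perms n)                            ≡⟨ +length≡∑1 (perms n) ⟩
  ∑[ σ ∈ perms n ] 1ℤ                            ≡⟨ ∑-cong (perms n) (λ σ → sym (𝟙-yes (λ _ ()) (agreesOutside? (λ _ → true) σ id))) ⟩
  ∑[ σ ∈ perms n ] 𝟙 (agreesOutside? (λ _ → true) σ id) ≡⟨ ∑-perms-agreesOutside n (λ _ → true) ⟩
  + (trues {n} (λ _ → true) !)                   ≡⟨ cong (λ t → + (t !)) (trues-const-true n) ⟩
  + (n !)                                        ∎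

+length-wreath : ∀ r n → + length (wreath r n) ≡ (+ r) ^ n * + (n !)
+length-wreath r n = begin
  + length (wreath r n)                                       ≡⟨ +length≡∑1 (wreath r n) ⟩
  ∑[ w ∈ wreath r n ] 1ℤ                                      ≡⟨ ∑-cartesianProduct (allFuns n (allFin r)) (perms n) _ ⟩
  ∑[ f ∈ allFuns n (allFin r) ] (∑[ σ ∈ perms n ] 1ℤ)          ≡⟨ ∑-cong (allFuns n (allFin r)) (λ _ → perms-count) ⟩
  ∑[ f ∈ allFuns n (allFin r) ] 1ℤ * + (n !)                  ≡⟨ ∑-*ʳ (allFuns n (allFin r)) (+ (n !)) (λ _ → 1ℤ) ⟩
  (∑[ f ∈ allFuns n (allFin r) ] 1ℤ) * + (n !)                ≡⟨ cong (_* + (n !)) (sym (+length≡∑1 (allFuns n (allFin r)))) ⟩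
  + length (allFuns n (allFin r)) * + (n !)                   ≡⟨ cong (_* + (n !)) (+length-allFuns n (allFin r)) ⟩
  (+ length (allFin r)) ^ n * + (n !)                         ≡⟨ cong (λ l → (+ l) ^ n * + (n !)) (Listₚ.length-tabulate id) ⟩
  (+ r) ^ n * + (n !)                                         ∎
  where
  perms-count : ∑[ σ ∈ perms n ] 1ℤ ≡ 1ℤ * + (n !)
  perms-count = trans (sym (+length≡∑1 (perms n))) (trans (+length-perms n) (sym (ℤₚ.*-identityˡ _)))

-- Sums over subsets

subsets : ∀ n → List (Fin n → Bool)
subsets n = allFuns n (true ∷ false ∷ [])

binomialSum : ℕ → (ℕ → ℤ) → ℤ
binomialSum n G = ∑[ j ∈ upTo (suc n) ] + (n C j) * G j

∑-upTo-suc : ∀ n (F : ℕ → ℤ) → ∑ (upTo (suc n)) F ≡ F 0 + (∑[ j ∈ upTo n ] F (suc j))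
∑-upTo-suc n F = cong (_+_ (F 0)) (trans (cong (λ js → ∑ js F) (sym (Listₚ.map-upTo suc n))) (∑-map suc (upTo n) F))

∑-upTo-last : ∀ n (F : ℕ → ℤ) → ∑ (upTo (suc n)) F ≡ ∑ (upTo n) F + F n
∑-upTo-last n F = begin
  ∑ (upTo (suc n)) F           ≡⟨ cong (λ js → ∑ js F) (sym (Listₚ.upTo-∷ʳ n)) ⟩
  ∑ (upTo n ++ n ∷ []) F        ≡⟨ ∑-++ (upTo n) (n ∷ []) F ⟩
  ∑ (upTo n) F + (F n + 0ℤ)     ≡⟨ cong (_+_ (∑ (upTo n) F)) (ℤₚ.+-identityʳ (F n)) ⟩
  ∑ (upTo n) F + F n            ∎

binomialSum-pad : ∀ n G → ∑[ j ∈ upTo (suc (suc n)) ] + (n C j) * G j ≡ binomialSum n G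
binomialSum-pad n G = begin
  ∑[ j ∈ upTo (suc (suc n)) ] + (n C j) * G j       ≡⟨ ∑-upTo-last (suc n) (λ j → + (n C j) * G j) ⟩
  binomialSum n G + + (n C suc n) * G (suc n)       ≡⟨ cong (λ c → binomialSum n G + + c * G (suc n)) (k>n⇒nCk≡0 (ℕₚ.n<1+n n)) ⟩
  binomialSum n G + 0ℤ * G (suc n)                  ≡⟨ cong (_+_ (binomialSum n G)) (ℤₚ.*-zeroˡ (G (suc n))) ⟩
  binomialSum n G + 0ℤ                              ≡⟨ ℤₚ.+-identityʳ _ ⟩
  binomialSum n G                                   ∎

binomialSum-suc : ∀ n G → binomialSum (suc n) G ≡ binomialSum n (G ∘ suc) + binomialSum n G
binomialSum-suc n G = begin
  binomialSum (suc n) G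
    ≡⟨ ∑-upTo-suc (suc n) (λ j → + (suc n C j) * G j) ⟩
  1ℤ * G 0 + (∑[ j ∈ upTo (suc n) ] + (suc n C suc j) * G (suc j))
    ≡⟨ cong (_+_ (1ℤ * G 0)) (∑-cong (upTo (suc n)) pascal) ⟩
  1ℤ * G 0 + (∑[ j ∈ upTo (suc n) ] (+ (n C j) * G (suc j) + + (n C suc j) * G (suc j)))
    ≡⟨ cong (_+_ (1ℤ * G 0)) (∑-+ (upTo (suc n)) (λ j → + (n C j) * G (suc j)) (λ j → + (n C suc j) * G (suc j))) ⟩
  1ℤ * G 0 + (binomialSum n (G ∘ suc) + (∑[ j ∈ upTo (suc n) ] + (n C suc j) * G (suc j)))
    ≡⟨ swap (1ℤ * G 0) (binomialSum n (G ∘ suc)) _ ⟩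
  binomialSum n (G ∘ suc) + (1ℤ * G 0 + (∑[ j ∈ upTo (suc n) ] + (n C suc j) * G (suc j)))
    ≡⟨ cong (_+_ (binomialSum n (G ∘ suc))) (sym (∑-upTo-suc (suc n) (λ j → + (n C j) * G j))) ⟩
  binomialSum n (G ∘ suc) + (∑[ j ∈ upTo (suc (suc n)) ] + (n C j) * G j)
    ≡⟨ cong (_+_ (binomialSum n (G ∘ suc))) (binomialSum-pad n G) ⟩
  binomialSum n (G ∘ suc) + binomialSum n G ∎
  where
  pascal : ∀ j → + (suc n C suc j) * G (suc j) ≡ + (n C j) * G (suc j) + + (n C suc j) * G (suc j)
  pascal j = begin
    + (suc n C suc j) * G (suc j)                          ≡⟨ cong (λ c → + c * G (suc j)) (sym (nCk+nC[k+1]≡[n+1]C[k+1] n j)) ⟩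
    + (n C j ℕ.+ n C suc j) * G (suc j)                    ≡⟨ cong (_* G (suc j)) (ℤₚ.pos-+ (n C j) (n C suc j)) ⟩
    (+ (n C j) + + (n C suc j)) * G (suc j)                ≡⟨ ℤₚ.*-distribʳ-+ (G (suc j)) (+ (n C j)) (+ (n C suc j)) ⟩
    + (n C j) * G (suc j) + + (n C suc j) * G (suc j)      ∎

  swap : ∀ a b c → a + (b + c) ≡ b + (a + c)
  swap = solve-∀

∑-subsets : ∀ n (G : ℕ → ℤ) → ∑[ A ∈ subsets n ] G (trues A) ≡ binomialSum n G
∑-subsets zero    G = cong (_+ 0ℤ) (sym (ℤₚ.*-identityˡ (G 0)))
∑-subsets (suc n) G = begin
  ∑[ A ∈ subsets (suc n) ] G (trues A)
    ≡⟨ ∑-allFuns-suc {n = n} (true ∷ false ∷ []) (λ b h → G ((if b then 1 else 0) ℕ.+ trues h)) ⟩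
  (∑[ h ∈ subsets n ] G (suc (trues h))) + ((∑[ h ∈ subsets n ] G (trues h)) + 0ℤ)
    ≡⟨ cong₂ _+_ (∑-subsets n (G ∘ suc)) (trans (ℤₚ.+-identityʳ _) (∑-subsets n G)) ⟩
  binomialSum n (G ∘ suc) + binomialSum n G
    ≡⟨ sym (binomialSum-suc n G) ⟩
  binomialSum (suc n) G ∎

∏ᶠ-expand : ∀ n (x : Fin n → ℤ) → ∏ᶠ (λ i → x i - 1ℤ) ≡ ∑[ A ∈ subsets n ] ∏ᶠ (λ i → if A i then -1ℤ else x i)
∏ᶠ-expand n x = begin
  ∏ᶠ (λ i → x i - 1ℤ)                                           ≡⟨ ∏ᶠ-cong (λ i → two-terms (x i)) ⟩
  ∏ᶠ (λ i → ∑[ b ∈ true ∷ false ∷ [] ] (if b then -1ℤ else x i)) ≡⟨ sym (∑-allFuns-∏ n (true ∷ false ∷ []) (λ i b → if b then -1ℤ else x i)) ⟩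
  ∑[ A ∈ subsets n ] ∏ᶠ (λ i → if A i then -1ℤ else x i)        ∎
  where two-terms : ∀ y → y - 1ℤ ≡ -1ℤ + (y + 0ℤ)
        two-terms = solve-∀

∏ᶠ-outside : ∀ {n} (A : Fin n → Bool) {Q : Fin n → Set} (Q? : ∀ i → Dec (Q i)) →
            ∏ᶠ (λ i → if A i then -1ℤ else 𝟙 (Q? i)) ≡ -1ℤ ^ trues A * 𝟙 (all? (λ i → (A i Bool.≟ false) →-dec Q? i))
∏ᶠ-outside A {Q} Q? = begin
  ∏ᶠ (λ i → if A i then -1ℤ else 𝟙 (Q? i))                        ≡⟨ ∏ᶠ-cong split ⟩
  ∏ᶠ (λ i → (if A i then -1ℤ else 1ℤ) * 𝟙 (outside? i))           ≡⟨ ∏ᶠ-* (λ i → if A i then -1ℤ else 1ℤ) (𝟙 ∘ outside?) ⟩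
  ∏ᶠ (λ i → if A i then -1ℤ else 1ℤ) * ∏ᶠ (λ i → 𝟙 (outside? i))  ≡⟨ cong₂ _*_ (∏ᶠ-if A -1ℤ) (sym (𝟙-∀ (all? outside?) outside?)) ⟩
  -1ℤ ^ trues A * 𝟙 (all? outside?)                               ∎
  where
  outside? : ∀ i → Dec (A i ≡ false → Q i)
  outside? i = (A i Bool.≟ false) →-dec Q? i

  split : ∀ i → (if A i then -1ℤ else 𝟙 (Q? i)) ≡ (if A i then -1ℤ else 1ℤ) * 𝟙 (outside? i)
  split i with A i
  ... | true  = refl
  ... | false = sym (ℤₚ.*-identityˡ _)

rhs≡∑-subsets : ∀ n x → rhs n x ≡ ∑[ A ∈ subsets n ] x ^ trues A * + (trues A !)
rhs≡∑-subsets n x = sym (trans (∑-subsets n (λ t → x ^ t * + (t !))) (∑-cong (upTo (suc n)) term))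
  where
  term : ∀ j → + (n C j) * (x ^ j * + (j !)) ≡ + ((n C j) ℕ.* (j !)) * x ^ j
  term j = trans (rearrange (+ (n C j)) (x ^ j) (+ (j !))) (cong (_* x ^ j) (sym (ℤₚ.pos-* (n C j) (j !))))
    where rearrange : ∀ c y f → c * (y * f) ≡ c * f * y
          rearrange = solve-∀

arrangements-count : ∀ r n → + length (arrangements r n) ≡ ∑[ A ∈ subsets n ] (+ r) ^ trues A * + (trues A !)
arrangements-count r n = begin
  + length (arrangements r n)                              ≡⟨ +length≡∑1 (arrangements r n) ⟩
  ∑[ x ∈ arrangements r n ] 1ℤ                             ≡⟨ ∑-concatMap (λ A → map (tag A) (wreath r (card A))) (subsets n) (λ _ → 1ℤ) ⟩
  ∑[ A ∈ subsets n ] ∑[ x ∈ map (tag A) (wreath r (card A)) ] 1ℤ ≡⟨ ∑-cong (subsets n) count-over ⟩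
  ∑[ A ∈ subsets n ] (+ r) ^ trues A * + (trues A !)      ∎
  where
  WreathElement : (Fin n → Bool) → Set
  WreathElement A = (Fin (card A) → Fin r) × (Fin (card A) → Fin (card A))

  -- Agda cannot infer the type family of the dependent section (A ,_) used in Defs.arrangements.
  tag : ∀ A → WreathElement A → Σ (Fin n → Bool) WreathElement
  tag A w = A , w

  count-over : ∀ A → ∑[ x ∈ map (tag A) (wreath r (card A)) ] 1ℤ ≡ (+ r) ^ trues A * + (trues A !)
  count-over A = begin
    ∑[ x ∈ map (tag A) (wreath r (card A)) ] 1ℤ   ≡⟨ ∑-map (tag A) (wreath r (card A)) (λ _ → 1ℤ) ⟩
    ∑[ w ∈ wreath r (card A) ] 1ℤ                ≡⟨ sym (+length≡∑1 (wreath r (card A))) ⟩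
    + length (wreath r (card A))                 ≡⟨ +length-wreath r (card A) ⟩
    (+ r) ^ card A * + (card A !)                ≡⟨ cong (λ t → (+ r) ^ t * + (t !)) (card≡trues A) ⟩
    (+ r) ^ trues A * + (trues A !)              ∎

-- Cyclic derangements

+C-cancel : ∀ {k} (s t : Fin (suc k)) → s +C t ≡ s → t ≡ zero
+C-cancel {k} s t s+t≡s = Finₚ.toℕ-injective (begin
  toℕ t           ≡⟨ sym (m<n⇒m%n≡m (Finₚ.toℕ<n t)) ⟩
  toℕ t % suc k   ≡⟨ n∣m⇒m%n≡0 (toℕ t) (suc k) (divides q t≡q*r) ⟩
  0               ∎)
  where
  q : ℕ
  q = (toℕ s ℕ.+ toℕ t) ℕ./ suc k

  remainder : (toℕ s ℕ.+ toℕ t) % suc k ≡ toℕ s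
  remainder = trans (sym (Finₚ.toℕ-fromℕ< _)) (cong toℕ s+t≡s)

  t≡q*r : toℕ t ≡ q ℕ.* suc k
  t≡q*r = ℕₚ.+-cancelˡ-≡ (toℕ s) _ _
            (trans (m≡m%n+[m/n]*n (toℕ s ℕ.+ toℕ t) (suc k)) (cong (ℕ._+ q ℕ.* suc k) remainder))

Fixes : ∀ {k n} → (Fin n → Fin (suc k)) → (Fin n → Fin n) → Fin n → Set
Fixes f σ i = σ i ≡ i × f i ≡ zero

fixes? : ∀ {k n} (f : Fin n → Fin (suc k)) σ i → Dec (Fixes f σ i)
fixes? f σ i = (σ i ≟ i) ×-dec (f i ≟ zero)

no-fixed-point⇔ : ∀ {k n} (f : Fin n → Fin (suc k)) σ → (¬ HasFixedPoint (f , σ)) ⇔ (∀ i → ¬ Fixes f σ i)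
no-fixed-point⇔ f σ = mk⇔ forward backward
  where
  forward : ¬ HasFixedPoint (f , σ) → ∀ i → ¬ Fixes f σ i
  forward no-fix i (σi≡i , fi≡0) = no-fix ((zero , i) , cong₂ _,_ (cong (zero +C_) (trans (cong f σi≡i) fi≡0)) σi≡i)

  backward : (∀ i → ¬ Fixes f σ i) → ¬ HasFixedPoint (f , σ)
  backward no-fixes ((s , i) , fixed) = no-fixes i (σi≡i , trans (cong f (sym σi≡i)) (+C-cancel s (f (σ i)) (cong proj₁ fixed)))
    where σi≡i : σ i ≡ i
          σi≡i = cong proj₂ fixed

𝟙-derangement : ∀ {k n} (f : Fin n → Fin (suc k)) σ →
                𝟙 (¬? (hasFixedPoint? (f , σ))) ≡ ∏ᶠ (λ i → 1ℤ - 𝟙 (fixes? f σ i))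
𝟙-derangement f σ = begin
  𝟙 (¬? (hasFixedPoint? (f , σ)))            ≡⟨ 𝟙-cong (no-fixed-point⇔ f σ) (¬? (hasFixedPoint? (f , σ))) (all? (¬? ∘ fixes? f σ)) ⟩
  𝟙 (all? (¬? ∘ fixes? f σ))                 ≡⟨ 𝟙-∀ (all? (¬? ∘ fixes? f σ)) (¬? ∘ fixes? f σ) ⟩
  ∏ᶠ (λ i → 𝟙 (¬? (fixes? f σ i)))          ≡⟨ ∏ᶠ-cong (𝟙-¬ ∘ fixes? f σ) ⟩
  ∏ᶠ (λ i → 1ℤ - 𝟙 (fixes? f σ i))          ∎

signed-𝟙-derangement : ∀ {k n} (f : Fin n → Fin (suc k)) σ →
  -1ℤ ^ n * 𝟙 (¬? (hasFixedPoint? (f , σ)))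
    ≡ ∑[ A ∈ subsets n ] -1ℤ ^ trues A * (𝟙 (agreesOutside? A σ id) * 𝟙 (agreesOutside? A f (λ _ → zero)))
signed-𝟙-derangement {n = n} f σ = begin
  -1ℤ ^ n * 𝟙 (¬? (hasFixedPoint? (f , σ)))
    ≡⟨ cong₂ _*_ (sym (∏ᶠ-const n -1ℤ)) (𝟙-derangement f σ) ⟩
  ∏ᶠ {n} (λ _ → -1ℤ) * ∏ᶠ (λ i → 1ℤ - 𝟙 (fixes? f σ i))
    ≡⟨ sym (∏ᶠ-* (λ _ → -1ℤ) (λ i → 1ℤ - 𝟙 (fixes? f σ i))) ⟩
  ∏ᶠ (λ i → -1ℤ * (1ℤ - 𝟙 (fixes? f σ i)))
    ≡⟨ ∏ᶠ-cong (λ i → negate (𝟙 (fixes? f σ i))) ⟩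
  ∏ᶠ (λ i → 𝟙 (fixes? f σ i) - 1ℤ)
    ≡⟨ ∏ᶠ-expand n (𝟙 ∘ fixes? f σ) ⟩
  ∑[ A ∈ subsets n ] ∏ᶠ (λ i → if A i then -1ℤ else 𝟙 (fixes? f σ i))
    ≡⟨ ∑-cong (subsets n) (λ A → trans (∏ᶠ-outside A (fixes? f σ)) (cong (-1ℤ ^ trues A *_) (separate A))) ⟩
  ∑[ A ∈ subsets n ] -1ℤ ^ trues A * (𝟙 (agreesOutside? A σ id) * 𝟙 (agreesOutside? A f (λ _ → zero))) ∎
  where
  negate : ∀ y → -1ℤ * (1ℤ - y) ≡ y - 1ℤ
  negate = solve-∀

  separate : ∀ A → 𝟙 (all? (λ i → (A i Bool.≟ false) →-dec fixes? f σ i))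
                   ≡ 𝟙 (agreesOutside? A σ id) * 𝟙 (agreesOutside? A f (λ _ → zero))
  separate A = trans (𝟙-cong (mk⇔ (λ h → (λ i e → proj₁ (h i e)) , (λ i e → proj₂ (h i e)))
                                  (λ (hσ , hf) i e → hσ i e , hf i e))
                             (all? (λ i → (A i Bool.≟ false) →-dec fixes? f σ i))
                             (agreesOutside? A σ id ×-dec agreesOutside? A f (λ _ → zero)))
                     (𝟙-× (agreesOutside? A σ id) (agreesOutside? A f (λ _ → zero)))

signed-derangements-count : ∀ k n → -1ℤ ^ n * + derangements k n ≡ ∑[ A ∈ subsets n ] -[1+ k ] ^ trues A * + (trues A !)
signed-derangements-count k n = begin
  -1ℤ ^ n * + derangements k n
    ≡⟨ cong (-1ℤ ^ n *_) (+length-filter (¬? ∘ hasFixedPoint?) (wreath r n)) ⟩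
  -1ℤ ^ n * (∑[ w ∈ wreath r n ] 𝟙 (¬? (hasFixedPoint? w)))
    ≡⟨ sym (∑-*ˡ (wreath r n) (-1ℤ ^ n) (λ w → 𝟙 (¬? (hasFixedPoint? w)))) ⟩
  ∑[ w ∈ wreath r n ] -1ℤ ^ n * 𝟙 (¬? (hasFixedPoint? w))
    ≡⟨ ∑-cartesianProduct (allFuns n (allFin r)) (perms n) _ ⟩
  ∑[ f ∈ allFuns n (allFin r) ] ∑[ σ ∈ perms n ] -1ℤ ^ n * 𝟙 (¬? (hasFixedPoint? (f , σ)))
    ≡⟨ ∑-cong (allFuns n (allFin r)) (λ f → ∑-cong (perms n) (signed-𝟙-derangement f)) ⟩
  ∑[ f ∈ allFuns n (allFin r) ] ∑[ σ ∈ perms n ] ∑[ A ∈ subsets n ]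
      -1ℤ ^ trues A * (𝟙 (agreesOutside? A σ id) * 𝟙 (agreesOutside? A f (λ _ → zero)))
    ≡⟨ ∑∑∑-separate (allFuns n (allFin r)) (perms n) (subsets n) (λ A → -1ℤ ^ trues A)
                    (λ σ A → 𝟙 (agreesOutside? A σ id)) (λ f A → 𝟙 (agreesOutside? A f (λ _ → zero))) ⟩
  ∑[ A ∈ subsets n ] -1ℤ ^ trues A * ((∑[ σ ∈ perms n ] 𝟙 (agreesOutside? A σ id))
                                     * (∑[ f ∈ allFuns n (allFin r) ] 𝟙 (agreesOutside? A f (λ _ → zero))))
    ≡⟨ ∑-cong (subsets n) (λ A → cong (-1ℤ ^ trues A *_)
                                      (cong₂ _*_ (∑-perms-agreesOutside n A) (∑-agreesOutside A (λ _ → zero)))) ⟩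
  ∑[ A ∈ subsets n ] -1ℤ ^ trues A * (+ (trues A !) * (+ r) ^ trues A)
    ≡⟨ ∑-cong (subsets n) (λ A → signed-term (trues A)) ⟩
  ∑[ A ∈ subsets n ] -[1+ k ] ^ trues A * + (trues A !) ∎
  where
  r : ℕ
  r = suc k

  signed-term : ∀ t → -1ℤ ^ t * (+ (t !) * (+ r) ^ t) ≡ -[1+ k ] ^ t * + (t !)
  signed-term t = begin
    -1ℤ ^ t * (+ (t !) * (+ r) ^ t)   ≡⟨ rearrange (-1ℤ ^ t) (+ (t !)) ((+ r) ^ t) ⟩
    (-1ℤ ^ t * (+ r) ^ t) * + (t !)   ≡⟨ cong (_* + (t !)) (-1^n*x^n≡[-x]^n (+ r) t) ⟩
    -[1+ k ] ^ t * + (t !)            ∎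
    where rearrange : ∀ s f p → s * (f * p) ≡ (s * p) * f
          rearrange = solve-∀

-- The identity also holds for n = 0.
lemma4p3 : (r : ℤ) → r ≢ + 0 → (n : ℕ) → 1 ≤ n → a n r ≡ rhs n r
lemma4p3 (+ zero)  r≢0 n _ = contradiction refl r≢0
lemma4p3 (+ suc k) _   n _ = trans (arrangements-count (suc k) n) (sym (rhs≡∑-subsets n (+ suc k)))
lemma4p3 -[1+ k ]  _   n _ = trans (signed-derangements-count k n) (sym (rhs≡∑-subsets n -[1+ k ]))
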